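{- Let $q$ be a prime power and $t\ge 0$ an integer. If $M$ is a rank-$(\leq t)$ perturbation of a $\mathrm{GF}(q)$-represented matroid $N$, then \[\varepsilon(M)\leq q^t\varepsilon(N)+\sum_{i=0}^{t-1} q^i.\]
   Context: For a matroid $M$, $\varepsilon(M)$ denotes the number of rank-1 flats of $M$ (the number of elements of its simplification). A $\mathrm{GF}(q)$-represented matroid is a matroid with a fixed class of representation matrices over $\mathrm{GF}(q)$ that are row equivalent up to column scaling and removal of zero rows; $M(A)$ is the vector matroid of $A$. $M$ is a rank-$(\leq t)$ perturbation of $N$ if there are matrices $A_1,P$ over $\mathrm{GF}(q)$ with $M(A_1)=N$, $\mathrm{rank}(P)\le t$ and $M(A_1+P)=M$. -}

module Defs where

open import Level using (0ℓ)
open import Data.Nat using (ℕ; zero; suc; _+_; _*_; _^_)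
open import Data.Fin using (Fin; zero; suc; _<_)
open import Data.Product using (Σ; ∃; _×_; _,_)
open import Data.Sum using (_⊎_)
open import Relation.Nullary using (¬_)
open import Relation.Binary.PropositionalEquality using (_≡_; _≢_)
open import Algebra.Structures using (IsCommutativeRing)
open import Function.Bundles using (_↔_)

-- A field with (propositional) equality; GF(q) is a
-- field whose carrier is in bijection with Fin q.  (Such a field exists
-- exactly when q is a prime power, and it is unique up to isomorphism.)

record Field : Set₁ where
  infixl 7 _·_
  infixl 6 _⊕_
  field
    Carrier : Set
    _⊕_ _·_ : Carrier → Carrier → Carrier
    ⊖_      : Carrier → Carrier
    𝟘 𝟙     : Carrier
    isCommutativeRing : IsCommutativeRing _≡_ _⊕_ _·_ ⊖_ 𝟘 𝟙
    𝟘≢𝟙     : 𝟘 ≢ 𝟙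
    inverse : ∀ x → x ≢ 𝟘 → ∃ λ y → x · y ≡ 𝟙

IsGF : ℕ → Field → Set
IsGF q F = Fin q ↔ Field.Carrier F

module _ (F : Field) where
  open Field F

  Matrix : ℕ → ℕ → Set
  Matrix m n = Fin m → Fin n → Carrier

  _+ᴹ_ : ∀ {m n} → Matrix m n → Matrix m n → Matrix m n
  (A +ᴹ B) i j = A i j ⊕ B i j

  ΣF : ∀ k → (Fin k → Carrier) → Carrier
  ΣF zero    f = 𝟘
  ΣF (suc k) f = f zero ⊕ ΣF k (λ i → f (suc i))

  Dependent : ∀ {m n k} → Matrix m n → (Fin k → Fin n) → Set
  Dependent {m} {n} {k} A idx =
    Σ (Fin k → Carrier) λ c →
      (Σ (Fin k) λ i → c i ≢ 𝟘) ×
      (∀ (r : Fin m) → ΣF k (λ i → c i · A r (idx i)) ≡ 𝟘)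

  -- Rank of a matrix is at most t: every t+1 distinct columns are
  -- linearly dependent (rank = maximum number of independent columns).
  RankAtMost : ∀ {m n} → ℕ → Matrix m n → Set
  RankAtMost {m} {n} t P =
    (idx : Fin (suc t) → Fin n) →
    (∀ i j → idx i ≡ idx j → i ≡ j) → Dependent P idx

  -- Elements of the vector matroid M(A) are the column indices Fin n.
  single : ∀ {n} → Fin n → Fin 1 → Fin n
  single e _ = e

  pair : ∀ {n} → Fin n → Fin n → Fin 2 → Fin n
  pair e f zero    = e
  pair e f (suc _) = f

  Loop : ∀ {m n} → Matrix m n → Fin n → Set
  Loop A e = Dependent A (single e)

  -- distinct e, f are parallel in M(A): {e,f} is a dependent set
  -- (for non-loops e, f this is the matroid parallel relation).
  Parallel : ∀ {m n} → Matrix m n → Fin n → Fin n → Set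
  Parallel A e f = e ≢ f × Dependent A (pair e f)

  -- ε(M(A)) = s: M(A) has a simplification with s elements, i.e. there
  -- are s non-loop elements, pairwise non-parallel, such that every
  -- non-loop element is one of them or parallel to one of them
  -- (one representative per parallel class = per rank-1 flat).
  HasEpsilon : ∀ {m n} → Matrix m n → ℕ → Set
  HasEpsilon {m} {n} A s =
    Σ (Fin s → Fin n) λ g →
      (∀ i → ¬ Loop A (g i)) ×
      (∀ i j → i ≢ j → (g i ≢ g j) × ¬ Parallel A (g i) (g j)) ×
      (∀ e → ¬ Loop A e → Σ (Fin s) λ i → (e ≡ g i) ⊎ Parallel A e (g i))

geomSum : ℕ → ℕ → ℕ
geomSum q zero    = 0
geomSum q (suc t) = q ^ t + geomSum q t

module Submission where

-- Some k ≤ t distinct columns w of P span all columns of P (start from all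
-- columns and repeatedly drop one taking part in a dependency).  A non-loop
-- e of M has column B_e = A₁_e + P_e ≠ 0.  If A₁_e = 0 then B_e = Σ lᵢ wᵢ
-- with l ≠ 0, and e is recorded by the projective point [l], one of at
-- most Σ_{i<k} q^i.  Otherwise A₁_e = μ·A₁_(g j) for a representative g j
-- of a simplification of N and μ ≠ 0, so B_e = μ·(A₁_(g j) + Σ νᵢ wᵢ), and
-- e is recorded by (ν, j), one of q^k ε(N).  Equal records give
-- proportional, hence parallel, columns, so records are injective on a
-- simplification of M.

open import Defs
open import Data.Nat using (ℕ; _≤_; _+_; _*_; _^_)
open import Level using (0ℓ)
open import Data.Nat using (zero; suc; _∸_; z≤n; _≤′_; ≤′-refl; ≤′-step; NonZero)
import Data.Nat.Properties as ℕₚ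
open import Data.Fin using (Fin; zero; suc; _↑ˡ_; _↑ʳ_; splitAt; join; punchIn; combine)
import Data.Fin.Properties as Finₚ
open import Data.Product using (Σ; _×_; _,_; proj₁; proj₂)
open import Data.Sum using (_⊎_; inj₁; inj₂; [_,_]′)
open import Data.Sum.Properties using (inj₁-injective; inj₂-injective)
open import Data.Empty using (⊥-elim)
open import Function using (_∘_; id)
open import Function.Bundles using (_↣_; Injection; Inverse)
open import Function.Properties.Inverse using (↔-sym; ↔⇒↣)
open import Relation.Nullary using (¬_; yes; no)
open import Relation.Binary.Definitions using (DecidableEquality)
open import Relation.Binary.PropositionalEquality
open import Algebra.Bundles using (CommutativeRing)
open import Algebra.Structures using (IsCommutativeRing)
import Algebra.Properties.Ring as RingProperties
import Algebra.Properties.Semiring.Sum as SumProperties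

join-injective : ∀ a b (x y : Fin a ⊎ Fin b) → join a b x ≡ join a b y → x ≡ y
join-injective a b x y eq =
  trans (sym (Finₚ.splitAt-join a b x)) (trans (cong (splitAt a) eq) (Finₚ.splitAt-join a b y))

module FieldFacts (F : Field) where
  open Field F public
  open IsCommutativeRing isCommutativeRing public
    using (+-assoc; +-identityˡ; +-identityʳ; *-assoc; *-comm; *-identityˡ;
           *-identityʳ; distribˡ; distribʳ; zeroˡ; zeroʳ; -‿inverseʳ)
  open ≡-Reasoning

  commutativeRing : CommutativeRing 0ℓ 0ℓ
  commutativeRing = record { isCommutativeRing = isCommutativeRing }

  open RingProperties (CommutativeRing.ring commutativeRing) public
    using (-‿distribˡ-*; +-inverseˡ-unique)
  open SumProperties (CommutativeRing.semiring commutativeRing) public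
    using (sum; sum-cong-≗; sum-remove; ∑-distrib-+; *-distribˡ-sum; sum-replicate-zero)

  inv : ∀ x → x ≢ 𝟘 → Carrier
  inv x x≢𝟘 = proj₁ (inverse x x≢𝟘)

  inv-inverseˡ : ∀ x (x≢𝟘 : x ≢ 𝟘) → inv x x≢𝟘 · x ≡ 𝟙
  inv-inverseˡ x x≢𝟘 = trans (*-comm _ x) (proj₂ (inverse x x≢𝟘))

  inv-cancelˡ : ∀ x (x≢𝟘 : x ≢ 𝟘) y → inv x x≢𝟘 · (x · y) ≡ y
  inv-cancelˡ x x≢𝟘 y = begin
    inv x x≢𝟘 · (x · y)  ≡⟨ *-assoc _ x y ⟨
    (inv x x≢𝟘 · x) · y  ≡⟨ cong (_· y) (inv-inverseˡ x x≢𝟘) ⟩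
    𝟙 · y                ≡⟨ *-identityˡ y ⟩
    y                    ∎

  inv-cancelʳ : ∀ x (x≢𝟘 : x ≢ 𝟘) y → x · (inv x x≢𝟘 · y) ≡ y
  inv-cancelʳ x x≢𝟘 y = begin
    x · (inv x x≢𝟘 · y)  ≡⟨ *-assoc x _ y ⟨
    (x · inv x x≢𝟘) · y  ≡⟨ cong (_· y) (proj₂ (inverse x x≢𝟘)) ⟩
    𝟙 · y                ≡⟨ *-identityˡ y ⟩
    y                    ∎

  inv-nonzero : ∀ x (x≢𝟘 : x ≢ 𝟘) → inv x x≢𝟘 ≢ 𝟘
  inv-nonzero x x≢𝟘 inv≡𝟘 = 𝟘≢𝟙 (begin
    𝟘              ≡⟨ zeroˡ x ⟨
    𝟘 · x          ≡⟨ cong (_· x) inv≡𝟘 ⟨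
    inv x x≢𝟘 · x  ≡⟨ inv-inverseˡ x x≢𝟘 ⟩
    𝟙              ∎)

  divide : ∀ x (x≢𝟘 : x ≢ 𝟘) {a y} → x · a ≡ y → a ≡ inv x x≢𝟘 · y
  divide x x≢𝟘 {a} eq = trans (sym (inv-cancelˡ x x≢𝟘 a)) (cong (inv x x≢𝟘 ·_) eq)

  nonzero-cancel : ∀ x {y} → x ≢ 𝟘 → x · y ≡ 𝟘 → y ≡ 𝟘
  nonzero-cancel x x≢𝟘 eq = trans (divide x x≢𝟘 eq) (zeroʳ _)

  eliminate : ∀ x y (y≢𝟘 : y ≢ 𝟘) → x ⊕ (⊖ (x · inv y y≢𝟘)) · y ≡ 𝟘
  eliminate x y y≢𝟘 = begin
    x ⊕ (⊖ (x · y⁻¹)) · y  ≡⟨ cong (x ⊕_) (-‿distribˡ-* _ y) ⟨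
    x ⊕ ⊖ ((x · y⁻¹) · y)  ≡⟨ cong (λ z → x ⊕ ⊖ z) (*-assoc x _ y) ⟩
    x ⊕ ⊖ (x · (y⁻¹ · y))  ≡⟨ cong (λ z → x ⊕ ⊖ (x · z)) (inv-inverseˡ y y≢𝟘) ⟩
    x ⊕ ⊖ (x · 𝟙)          ≡⟨ cong (λ z → x ⊕ ⊖ z) (*-identityʳ x) ⟩
    x ⊕ ⊖ x                ≡⟨ -‿inverseʳ x ⟩
    𝟘                      ∎
    where
    y⁻¹ : Carrier
    y⁻¹ = inv y y≢𝟘

  NonzeroVec : ∀ {k} → (Fin k → Carrier) → Set
  NonzeroVec {k} v = Σ (Fin k) λ i → v i ≢ 𝟘

  Proportional : ∀ {k} → (Fin k → Carrier) → (Fin k → Carrier) → Set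
  Proportional {k} v w =
    Σ Carrier λ s → Σ Carrier λ s′ → s ≢ 𝟘 × (∀ i → s · v i ≡ s′ · w i)

  multiples-proportional : ∀ {k} {v w x : Fin k → Carrier} μ μ′ → μ′ ≢ 𝟘 →
    (∀ i → v i ≡ μ · x i) → (∀ i → w i ≡ μ′ · x i) → Proportional v w
  multiples-proportional {v = v} {w} {x} μ μ′ μ′≢𝟘 v≡ w≡ =
    μ′ , μ , μ′≢𝟘 , λ i → begin
    μ′ · v i        ≡⟨ cong (μ′ ·_) (v≡ i) ⟩
    μ′ · (μ · x i)  ≡⟨ *-assoc μ′ μ (x i) ⟨
    (μ′ · μ) · x i  ≡⟨ cong (_· x i) (*-comm μ′ μ) ⟩
    (μ · μ′) · x i  ≡⟨ *-assoc μ μ′ (x i) ⟩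
    μ · (μ′ · x i)  ≡⟨ cong (μ ·_) (w≡ i) ⟨
    μ · w i         ∎

  ΣF≡sum : ∀ k (f : Fin k → Carrier) → ΣF F k f ≡ sum f
  ΣF≡sum zero    f = refl
  ΣF≡sum (suc k) f = cong (f zero ⊕_) (ΣF≡sum k (f ∘ suc))

  sum-split : ∀ a b (f : Fin (a + b) → Carrier) →
              sum f ≡ sum (λ i → f (i ↑ˡ b)) ⊕ sum (λ i → f (a ↑ʳ i))
  sum-split zero    b f = sym (+-identityˡ _)
  sum-split (suc a) b f =
    trans (cong (f zero ⊕_) (sum-split a b (f ∘ suc))) (sym (+-assoc _ _ _))

module Combinations (F : Field) where
  open FieldFacts F
  open ≡-Reasoning

  combo : ∀ {m n k} → Matrix F m n → (Fin k → Fin n) → (Fin k → Carrier) → Fin m → Carrier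
  combo {k = k} A idx l r = ΣF F k (λ i → l i · A r (idx i))

  module _ {m n k} (A : Matrix F m n) (idx : Fin k → Fin n) where

    combo≡sum : ∀ l r → combo A idx l r ≡ sum (λ i → l i · A r (idx i))
    combo≡sum l r = ΣF≡sum k _

    combo-cong : ∀ {l l′} → (∀ i → l i ≡ l′ i) → ∀ r → combo A idx l r ≡ combo A idx l′ r
    combo-cong {l} {l′} l≡l′ r = begin
      combo A idx l r                   ≡⟨ combo≡sum l r ⟩
      sum (λ i → l i · A r (idx i))     ≡⟨ sum-cong-≗ (λ i → cong (_· A r (idx i)) (l≡l′ i)) ⟩
      sum (λ i → l′ i · A r (idx i))    ≡⟨ combo≡sum l′ r ⟨
      combo A idx l′ r                  ∎

    combo-zero : ∀ {l} → (∀ i → l i ≡ 𝟘) → ∀ r → combo A idx l r ≡ 𝟘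
    combo-zero {l} l≡𝟘 r = begin
      combo A idx l r                ≡⟨ combo≡sum l r ⟩
      sum (λ i → l i · A r (idx i))
        ≡⟨ sum-cong-≗ (λ i → trans (cong (_· A r (idx i)) (l≡𝟘 i)) (zeroˡ _)) ⟩
      sum {k} (λ _ → 𝟘)              ≡⟨ sum-replicate-zero k ⟩
      𝟘                              ∎

    combo-scale : ∀ a l r → a · combo A idx l r ≡ combo A idx (λ i → a · l i) r
    combo-scale a l r = begin
      a · combo A idx l r                   ≡⟨ cong (a ·_) (combo≡sum l r) ⟩
      a · sum (λ i → l i · A r (idx i))     ≡⟨ *-distribˡ-sum a (λ i → l i · A r (idx i)) ⟩
      sum (λ i → a · (l i · A r (idx i)))   ≡⟨ sum-cong-≗ (λ i → *-assoc a (l i) _) ⟨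
      sum (λ i → (a · l i) · A r (idx i))   ≡⟨ combo≡sum _ r ⟨
      combo A idx (λ i → a · l i) r         ∎

    combo-add-multiple : ∀ l a c r →
      combo A idx (λ i → l i ⊕ a · c i) r ≡ combo A idx l r ⊕ a · combo A idx c r
    combo-add-multiple l a c r = begin
      combo A idx (λ i → l i ⊕ a · c i) r
        ≡⟨ combo≡sum _ r ⟩
      sum (λ i → (l i ⊕ a · c i) · A r (idx i))
        ≡⟨ sum-cong-≗ (λ i → distribʳ (A r (idx i)) (l i) (a · c i)) ⟩
      sum (λ i → l i · A r (idx i) ⊕ (a · c i) · A r (idx i))
        ≡⟨ ∑-distrib-+ (λ i → l i · A r (idx i)) (λ i → (a · c i) · A r (idx i)) ⟩
      sum (λ i → l i · A r (idx i)) ⊕ sum (λ i → (a · c i) · A r (idx i))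
        ≡⟨ cong₂ _⊕_ (combo≡sum l r) (combo≡sum _ r) ⟨
      combo A idx l r ⊕ combo A idx (λ i → a · c i) r
        ≡⟨ cong (combo A idx l r ⊕_) (combo-scale a c r) ⟨
      combo A idx l r ⊕ a · combo A idx c r
        ∎

    combo-proportional : ∀ {l l′} → Proportional l l′ →
      Proportional (combo A idx l) (combo A idx l′)
    combo-proportional {l} {l′} (s , s′ , s≢𝟘 , sl≡s′l′) = s , s′ , s≢𝟘 , λ r → begin
      s · combo A idx l r                ≡⟨ combo-scale s l r ⟩
      combo A idx (λ i → s · l i) r      ≡⟨ combo-cong sl≡s′l′ r ⟩
      combo A idx (λ i → s′ · l′ i) r    ≡⟨ combo-scale s′ l′ r ⟨
      s′ · combo A idx l′ r              ∎

  combo-pivot : ∀ {m n k} (A : Matrix F m n) (idx : Fin (suc k) → Fin n) l p r →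
    combo A idx l r ≡ l p · A r (idx p) ⊕ combo A (idx ∘ punchIn p) (l ∘ punchIn p) r
  combo-pivot A idx l p r = begin
    combo A idx l r
      ≡⟨ combo≡sum A idx l r ⟩
    sum (λ i → l i · A r (idx i))
      ≡⟨ sum-remove {i = p} (λ i → l i · A r (idx i)) ⟩
    l p · A r (idx p) ⊕ sum (λ i → l (punchIn p i) · A r (idx (punchIn p i)))
      ≡⟨ cong (_ ⊕_) (combo≡sum A (idx ∘ punchIn p) (l ∘ punchIn p) r) ⟨
    l p · A r (idx p) ⊕ combo A (idx ∘ punchIn p) (l ∘ punchIn p) r
      ∎

  combo-remove : ∀ {m n k} (A : Matrix F m n) (idx : Fin (suc k) → Fin n) l p →
    l p ≡ 𝟘 → ∀ r → combo A idx l r ≡ combo A (idx ∘ punchIn p) (l ∘ punchIn p) r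
  combo-remove A idx l p lₚ≡𝟘 r = begin
    combo A idx l r            ≡⟨ combo-pivot A idx l p r ⟩
    l p · A r (idx p) ⊕ rest   ≡⟨ cong (λ z → z · A r (idx p) ⊕ rest) lₚ≡𝟘 ⟩
    𝟘 · A r (idx p) ⊕ rest     ≡⟨ cong (_⊕ rest) (zeroˡ _) ⟩
    𝟘 ⊕ rest                   ≡⟨ +-identityˡ rest ⟩
    rest                       ∎
    where
    rest : Carrier
    rest = combo A (idx ∘ punchIn p) (l ∘ punchIn p) r

  unit : ∀ {n} → Fin n → Fin n → Carrier
  unit e i with i Finₚ.≟ e
  ... | yes _ = 𝟙
  ... | no _  = 𝟘

  unit-self : ∀ {n} (e : Fin n) → unit e e ≡ 𝟙
  unit-self e with e Finₚ.≟ e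
  ... | yes _   = refl
  ... | no e≢e = ⊥-elim (e≢e refl)

  unit-other : ∀ {n} (e i : Fin n) → i ≢ e → unit e i ≡ 𝟘
  unit-other e i i≢e with i Finₚ.≟ e
  ... | yes i≡e = ⊥-elim (i≢e i≡e)
  ... | no _    = refl

  column-as-combo : ∀ {m n} (A : Matrix F m n) e r → A r e ≡ combo A id (unit e) r
  column-as-combo {n = suc _} A e r = sym (begin
    combo A id (unit e) r
      ≡⟨ combo-pivot A id (unit e) e r ⟩
    unit e e · A r e ⊕ combo A (punchIn e) (unit e ∘ punchIn e) r
      ≡⟨ cong₂ _⊕_ (cong (_· A r e) (unit-self e))
                   (combo-zero A (punchIn e) (λ i → unit-other e _ (Finₚ.punchInᵢ≢i e i)) r) ⟩
    𝟙 · A r e ⊕ 𝟘  ≡⟨ +-identityʳ _ ⟩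
    𝟙 · A r e      ≡⟨ *-identityˡ _ ⟩
    A r e          ∎)

  combo-split : ∀ {m n a b} (A : Matrix F m n) (idx : Fin (a + b) → Fin n) l r →
    combo A idx l r ≡ combo A (idx ∘ (_↑ˡ b)) (l ∘ (_↑ˡ b)) r ⊕ combo A (idx ∘ (a ↑ʳ_)) (l ∘ (a ↑ʳ_)) r
  combo-split {a = a} {b} A idx l r = begin
    combo A idx l r
      ≡⟨ combo≡sum A idx l r ⟩
    sum (λ i → l i · A r (idx i))
      ≡⟨ sum-split a b (λ i → l i · A r (idx i)) ⟩
    sum (λ i → l (i ↑ˡ b) · A r (idx (i ↑ˡ b))) ⊕ sum (λ i → l (a ↑ʳ i) · A r (idx (a ↑ʳ i)))
      ≡⟨ cong₂ _⊕_ (combo≡sum A (idx ∘ (_↑ˡ b)) (l ∘ (_↑ˡ b)) r)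
                   (combo≡sum A (idx ∘ (a ↑ʳ_)) (l ∘ (a ↑ʳ_)) r) ⟨
    combo A (idx ∘ (_↑ˡ b)) (l ∘ (_↑ˡ b)) r ⊕ combo A (idx ∘ (a ↑ʳ_)) (l ∘ (a ↑ʳ_)) r
      ∎

  extend-by-zero : ∀ {a} b → (Fin a → Carrier) → Fin (a + b) → Carrier
  extend-by-zero {a} b c i = [ c , (λ _ → 𝟘) ]′ (splitAt a i)

  extend-by-zero-↑ˡ : ∀ {a} b (c : Fin a → Carrier) i → extend-by-zero b c (i ↑ˡ b) ≡ c i
  extend-by-zero-↑ˡ {a} b c i = cong [ c , (λ _ → 𝟘) ]′ (Finₚ.splitAt-↑ˡ a i b)

  extend-by-zero-↑ʳ : ∀ {a} b (c : Fin a → Carrier) i → extend-by-zero b c (a ↑ʳ i) ≡ 𝟘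
  extend-by-zero-↑ʳ {a} b c i = cong [ c , (λ _ → 𝟘) ]′ (Finₚ.splitAt-↑ʳ a b i)

  dependent-superfamily : ∀ {m n a b} (A : Matrix F m n) (idx : Fin (a + b) → Fin n) →
    Dependent F A (idx ∘ (_↑ˡ b)) → Dependent F A idx
  dependent-superfamily {a = a} {b} A idx (c , (p , cₚ≢𝟘) , c-vanishes) =
    c′ , (p ↑ˡ b , c′ₚ≢𝟘) , c′-vanishes
    where
    c′ : Fin (a + b) → Carrier
    c′ = extend-by-zero b c
    c′ₚ≢𝟘 : c′ (p ↑ˡ b) ≢ 𝟘
    c′ₚ≢𝟘 c′ₚ≡𝟘 = cₚ≢𝟘 (trans (sym (extend-by-zero-↑ˡ b c p)) c′ₚ≡𝟘)
    c′-vanishes : ∀ r → combo A idx c′ r ≡ 𝟘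
    c′-vanishes r = begin
      combo A idx c′ r
        ≡⟨ combo-split {a = a} A idx c′ r ⟩
      combo A (idx ∘ (_↑ˡ b)) (c′ ∘ (_↑ˡ b)) r ⊕ combo A (idx ∘ (a ↑ʳ_)) (c′ ∘ (a ↑ʳ_)) r
        ≡⟨ cong₂ _⊕_ (combo-cong A _ (extend-by-zero-↑ˡ b c) r)
                     (combo-zero A _ (extend-by-zero-↑ʳ b c) r) ⟩
      combo A (idx ∘ (_↑ˡ b)) c r ⊕ 𝟘
        ≡⟨ +-identityʳ _ ⟩
      combo A (idx ∘ (_↑ˡ b)) c r
        ≡⟨ c-vanishes r ⟩
      𝟘 ∎

module Columns (F : Field) where
  open FieldFacts F
  open ≡-Reasoning

  column : ∀ {m n} → Matrix F m n → Fin n → Fin m → Carrier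
  column A e r = A r e

  zero-column⇒loop : ∀ {m n} (A : Matrix F m n) e → (∀ r → A r e ≡ 𝟘) → Loop F A e
  zero-column⇒loop A e Aₑ≡𝟘 =
    (λ _ → 𝟙) , (zero , λ 𝟙≡𝟘 → 𝟘≢𝟙 (sym 𝟙≡𝟘)) ,
    λ r → trans (+-identityʳ _) (trans (*-identityˡ _) (Aₑ≡𝟘 r))

  loop⇒zero-column : ∀ {m n} (A : Matrix F m n) e → Loop F A e → ∀ r → A r e ≡ 𝟘
  loop⇒zero-column A e (c , (zero , c₀≢𝟘) , c-vanishes) r =
    nonzero-cancel (c zero) c₀≢𝟘 (trans (sym (+-identityʳ _)) (c-vanishes r))

  proportional⇒dependent : ∀ {m n} (A : Matrix F m n) e f →
    Proportional (column A e) (column A f) → Dependent F A (pair F e f)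
  proportional⇒dependent A e f (s , s′ , s≢𝟘 , s·e≡s′·f) = c , (zero , s≢𝟘) , λ r → begin
    s · A r e ⊕ ((⊖ s′) · A r f ⊕ 𝟘)  ≡⟨ cong₂ _⊕_ (s·e≡s′·f r) (+-identityʳ _) ⟩
    s′ · A r f ⊕ (⊖ s′) · A r f       ≡⟨ cong (s′ · A r f ⊕_) (-‿distribˡ-* s′ _) ⟨
    s′ · A r f ⊕ ⊖ (s′ · A r f)       ≡⟨ -‿inverseʳ _ ⟩
    𝟘                                 ∎
    where
    c : Fin 2 → Carrier
    c zero    = s
    c (suc _) = ⊖ s′

  second-coefficient-nonzero : (c : Fin 2 → Carrier) (i : Fin 2) →
    c i ≢ 𝟘 → c zero ≡ 𝟘 → c (suc zero) ≢ 𝟘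
  second-coefficient-nonzero c zero       c₀≢𝟘 c₀≡𝟘 = ⊥-elim (c₀≢𝟘 c₀≡𝟘)
  second-coefficient-nonzero c (suc zero) c₁≢𝟘 _    = c₁≢𝟘

  dependent⇒multiple : DecidableEquality Carrier → ∀ {m n} (A : Matrix F m n) e f →
    ¬ Loop F A f → Dependent F A (pair F e f) → Σ Carrier λ μ → ∀ r → A r e ≡ μ · A r f
  dependent⇒multiple _≟_ A e f f-nonloop (c , (i , cᵢ≢𝟘) , c-vanishes) with c zero ≟ 𝟘
  ... | yes c₀≡𝟘 = ⊥-elim (f-nonloop (zero-column⇒loop A f A_f≡𝟘))
    where
    c₁≢𝟘 : c (suc zero) ≢ 𝟘
    c₁≢𝟘 = second-coefficient-nonzero c i cᵢ≢𝟘 c₀≡𝟘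
    A_f≡𝟘 : ∀ r → A r f ≡ 𝟘
    A_f≡𝟘 r = nonzero-cancel (c (suc zero)) c₁≢𝟘 (begin
      c (suc zero) · A r f            ≡⟨ +-identityʳ _ ⟨
      second-term                     ≡⟨ +-identityˡ _ ⟨
      𝟘 ⊕ second-term                 ≡⟨ cong (_⊕ second-term) first-term≡𝟘 ⟨
      c zero · A r e ⊕ second-term    ≡⟨ c-vanishes r ⟩
      𝟘                               ∎)
      where
      second-term : Carrier
      second-term = c (suc zero) · A r f ⊕ 𝟘
      first-term≡𝟘 : c zero · A r e ≡ 𝟘
      first-term≡𝟘 = trans (cong (_· A r e) c₀≡𝟘) (zeroˡ _)
  ... | no c₀≢𝟘 = inv (c zero) c₀≢𝟘 · ⊖ c (suc zero) , λ r → begin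
      A r e                                           ≡⟨ divide (c zero) c₀≢𝟘 (solved r) ⟩
      inv (c zero) c₀≢𝟘 · ((⊖ c (suc zero)) · A r f)  ≡⟨ *-assoc _ _ _ ⟨
      (inv (c zero) c₀≢𝟘 · ⊖ c (suc zero)) · A r f    ∎
    where
    solved : ∀ r → c zero · A r e ≡ (⊖ c (suc zero)) · A r f
    solved r = trans (+-inverseˡ-unique _ _ pair-vanishes) (-‿distribˡ-* _ _)
      where
      pair-vanishes : c zero · A r e ⊕ c (suc zero) · A r f ≡ 𝟘
      pair-vanishes = trans (cong (c zero · A r e ⊕_) (sym (+-identityʳ _))) (c-vanishes r)

  representative-multiple : DecidableEquality Carrier → ∀ {m n s} (A : Matrix F m n)
    (simple : HasEpsilon F A s) e → ¬ Loop F A e →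
    Σ (Fin s) λ j → Σ Carrier λ μ → ∀ r → A r e ≡ μ · A r (proj₁ simple j)
  representative-multiple _≟_ A (g , g-nonloop , _ , covers) e e-nonloop with covers e e-nonloop
  ... | j , inj₁ e≡gⱼ       = j , 𝟙 , λ r → trans (cong (A r) e≡gⱼ) (sym (*-identityˡ _))
  ... | j , inj₂ (_ , dep) = j , dependent⇒multiple _≟_ A e (g j) (g-nonloop j) dep

  ε-bound : ∀ {m n s b} (A : Matrix F m n) → HasEpsilon F A s →
    (label : ∀ e → ¬ Loop F A e → Fin b) →
    (∀ e f e-nonloop f-nonloop →
       label e e-nonloop ≡ label f f-nonloop → Dependent F A (pair F e f)) →
    s ≤ b
  ε-bound A (g , g-nonloop , distinct , _) label same-label⇒dependent =
    Finₚ.injective⇒≤ {f = λ i → label (g i) (g-nonloop i)} injective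
    where
    injective : ∀ {i j} → label (g i) (g-nonloop i) ≡ label (g j) (g-nonloop j) → i ≡ j
    injective {i} {j} same with i Finₚ.≟ j
    ... | yes i≡j = i≡j
    ... | no i≢j  = ⊥-elim (proj₂ (distinct i j i≢j)
                      (proj₁ (distinct i j i≢j) , same-label⇒dependent _ _ _ _ same))

module Spanning (F : Field) {m n} (P : Matrix F m n) where
  open FieldFacts F
  open Combinations F
  open ≡-Reasoning

  Spans : ∀ {k} → (Fin k → Fin n) → Set
  Spans {k} idx = ∀ e → Σ (Fin k → Carrier) λ l → ∀ r → P r e ≡ combo P idx l r

  SpanningFamily : ℕ → Set
  SpanningFamily k = Σ (Fin k → Fin n) λ idx → (∀ i j → idx i ≡ idx j → i ≡ j) × Spans idx

  all-columns : SpanningFamily n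
  all-columns = id , (λ _ _ i≡j → i≡j) , λ e → unit e , column-as-combo P e

  -- A column taking part in a dependency of a spanning family can be
  -- dropped: use the dependency to eliminate its coefficient.
  drop-dependent : ∀ {k} (idx : Fin (suc k) → Fin n) → Spans idx →
    (c : Fin (suc k) → Carrier) (p : Fin (suc k)) → c p ≢ 𝟘 →
    (∀ r → combo P idx c r ≡ 𝟘) → Spans (idx ∘ punchIn p)
  drop-dependent {k} idx spans c p cₚ≢𝟘 c-vanishes e with spans e
  ... | l , Pₑ≡ = L ∘ punchIn p , λ r → begin
    P r e                                   ≡⟨ Pₑ≡ r ⟩
    combo P idx l r                         ≡⟨ +-identityʳ _ ⟨
    combo P idx l r ⊕ 𝟘                     ≡⟨ cong (combo P idx l r ⊕_) (zeroʳ d) ⟨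
    combo P idx l r ⊕ d · 𝟘                 ≡⟨ cong (λ z → combo P idx l r ⊕ d · z) (c-vanishes r) ⟨
    combo P idx l r ⊕ d · combo P idx c r   ≡⟨ combo-add-multiple P idx l d c r ⟨
    combo P idx L r                         ≡⟨ combo-remove P idx L p Lₚ≡𝟘 r ⟩
    combo P (idx ∘ punchIn p) (L ∘ punchIn p) r ∎
    where
    d : Carrier
    d = ⊖ (l p · inv (c p) cₚ≢𝟘)
    L : Fin (suc k) → Carrier
    L i = l i ⊕ d · c i
    Lₚ≡𝟘 : L p ≡ 𝟘
    Lₚ≡𝟘 = eliminate (l p) (c p) cₚ≢𝟘

  -- Rank ≤ t makes the first t+1 members of a family dependent, so a
  -- spanning family of size t+1+k can be shrunk by one.
  shrink : ∀ t → RankAtMost F t P → ∀ k → SpanningFamily (suc t + k) → SpanningFamily (t + k)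
  shrink t rank k (idx , idx-injective , spans)
    with dependent-superfamily P idx (rank (idx ∘ (_↑ˡ k))
           (λ i j eq → Finₚ.↑ˡ-injective k i j (idx-injective _ _ eq)))
  ... | c , (p , cₚ≢𝟘) , c-vanishes =
    idx ∘ punchIn p ,
    (λ i j eq → Finₚ.punchIn-injective p i j (idx-injective _ _ eq)) ,
    drop-dependent idx spans c p cₚ≢𝟘 c-vanishes

  small-spanning-family : ∀ t → RankAtMost F t P → Σ ℕ λ k → k ≤ t × SpanningFamily k
  small-spanning-family t rank = go n all-columns
    where
    go : ∀ K → SpanningFamily K → Σ ℕ λ k → k ≤ t × SpanningFamily k
    go zero    family = zero , z≤n , family
    go (suc K) family with suc K ℕₚ.≤? t
    ... | yes K<t = suc K , K<t , family
    ... | no K≮t  = go K (subst SpanningFamily t+[K∸t]≡K (shrink t rank (K ∸ t) family′))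
      where
      t+[K∸t]≡K : t + (K ∸ t) ≡ K
      t+[K∸t]≡K = ℕₚ.m+[n∸m]≡n (ℕₚ.≤-pred (ℕₚ.≰⇒> K≮t))
      family′ : SpanningFamily (suc t + (K ∸ t))
      family′ = subst SpanningFamily (sym (cong suc t+[K∸t]≡K)) family

-- Counting in GF(q)^k: vectors are coded injectively by Fin (q^k), and
-- nonzero vectors up to scaling (points of the projective space) by
-- Fin (1 + q + ⋯ + q^(k-1)), normalising the first nonzero entry to 𝟙.
module Counting (F : Field) (q : ℕ) (gf : IsGF q F) where
  open FieldFacts F
  open ≡-Reasoning

  element-code : Carrier ↣ Fin q
  element-code = ↔⇒↣ (↔-sym gf)

  open Injection element-code using () renaming (to to code₁; injective to code₁-injective)

  _≟_ : DecidableEquality Carrier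
  _≟_ = Finₚ.inj⇒≟ element-code

  vector-code : ∀ k → (Fin k → Carrier) → Fin (q ^ k)
  vector-code zero    v = zero
  vector-code (suc k) v = combine (code₁ (v zero)) (vector-code k (v ∘ suc))

  vector-code-injective : ∀ k {v w} → vector-code k v ≡ vector-code k w → ∀ i → v i ≡ w i
  vector-code-injective (suc k) {v} {w} same i
    with Finₚ.combine-injective (code₁ (v zero)) _ (code₁ (w zero)) _ same
  vector-code-injective (suc k) same zero    | head≡ , _ = code₁-injective head≡
  vector-code-injective (suc k) same (suc i) | _ , tail≡ = vector-code-injective k tail≡ i

  nonzero-tail : ∀ {k} (v : Fin (suc k) → Carrier) →
    NonzeroVec v → v zero ≡ 𝟘 → NonzeroVec (v ∘ suc)
  nonzero-tail v (zero  , v₀≢𝟘) v₀≡𝟘 = ⊥-elim (v₀≢𝟘 v₀≡𝟘)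
  nonzero-tail v (suc i , vᵢ≢𝟘) _    = i , vᵢ≢𝟘

  point-code : ∀ k (v : Fin k → Carrier) → NonzeroVec v → Fin (geomSum q k)
  point-code zero    v (() , _)
  point-code (suc k) v v≢𝟘 with v zero ≟ 𝟘
  ... | yes v₀≡𝟘 = join (q ^ k) (geomSum q k)
                     (inj₂ (point-code k (v ∘ suc) (nonzero-tail v v≢𝟘 v₀≡𝟘)))
  ... | no v₀≢𝟘  = join (q ^ k) (geomSum q k)
                     (inj₁ (vector-code k (λ i → inv (v zero) v₀≢𝟘 · v (suc i))))

  proportional-cons-zero : ∀ {k} {v w : Fin (suc k) → Carrier} → v zero ≡ 𝟘 → w zero ≡ 𝟘 →
    Proportional (v ∘ suc) (w ∘ suc) → Proportional v w
  proportional-cons-zero {v = v} {w} v₀≡𝟘 w₀≡𝟘 (s , s′ , s≢𝟘 , s·v≡s′·w) =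
    s , s′ , s≢𝟘 , λ { zero → head ; (suc i) → s·v≡s′·w i }
    where
    head : s · v zero ≡ s′ · w zero
    head = begin
      s · v zero   ≡⟨ cong (s ·_) v₀≡𝟘 ⟩
      s · 𝟘        ≡⟨ zeroʳ s ⟩
      𝟘            ≡⟨ zeroʳ s′ ⟨
      s′ · 𝟘       ≡⟨ cong (s′ ·_) w₀≡𝟘 ⟨
      s′ · w zero  ∎

  point-code-proportional : ∀ k (v w : Fin k → Carrier) v≢𝟘 w≢𝟘 →
    point-code k v v≢𝟘 ≡ point-code k w w≢𝟘 → Proportional v w
  point-code-proportional (suc k) v w v≢𝟘 w≢𝟘 same with v zero ≟ 𝟘 | w zero ≟ 𝟘
  ... | yes v₀≡𝟘 | yes w₀≡𝟘 =
    proportional-cons-zero v₀≡𝟘 w₀≡𝟘 (point-code-proportional k (v ∘ suc) (w ∘ suc) _ _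
      (inj₂-injective (join-injective (q ^ k) (geomSum q k) (inj₂ _) (inj₂ _) same)))
  ... | yes _ | no _ with join-injective (q ^ k) (geomSum q k) (inj₂ _) (inj₁ _) same
  ... | ()
  point-code-proportional (suc k) v w v≢𝟘 w≢𝟘 same | no _ | yes _
    with join-injective (q ^ k) (geomSum q k) (inj₁ _) (inj₂ _) same
  ... | ()
  point-code-proportional (suc k) v w v≢𝟘 w≢𝟘 same | no v₀≢𝟘 | no w₀≢𝟘 =
    inv (v zero) v₀≢𝟘 , inv (w zero) w₀≢𝟘 , inv-nonzero (v zero) v₀≢𝟘 , λ
      { zero    → trans (inv-inverseˡ (v zero) v₀≢𝟘) (sym (inv-inverseˡ (w zero) w₀≢𝟘))
      ; (suc i) → vector-code-injective k normalised-tails≡ i }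
    where
    normalised-tails≡ : vector-code k (λ i → inv (v zero) v₀≢𝟘 · v (suc i))
                      ≡ vector-code k (λ i → inv (w zero) w₀≢𝟘 · w (suc i))
    normalised-tails≡ = inj₁-injective (join-injective (q ^ k) (geomSum q k) (inj₁ _) (inj₁ _) same)

module Perturbation (F : Field) (q : ℕ) (gf : IsGF q F) {m n} (A₁ P : Matrix F m n)
                    {εN} (N-simple : HasEpsilon F A₁ εN)
                    {k} (w : Fin k → Fin n) (w-spans : Spanning.Spans F P w) where
  open FieldFacts F
  open Combinations F
  open Columns F
  open Counting F q gf
  open ≡-Reasoning

  B : Matrix F m n
  B = _+ᴹ_ F A₁ P

  g : Fin εN → Fin n
  g = proj₁ N-simple

  SpanExpression : Fin n → Set
  SpanExpression e = Σ (Fin k → Carrier) λ l → NonzeroVec l × (∀ r → B r e ≡ combo P w l r)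

  ShiftExpression : Fin n → Set
  ShiftExpression e = Σ (Fin εN) λ j → Σ (Fin k → Carrier) λ ν → Σ Carrier λ μ →
    μ ≢ 𝟘 × (∀ r → B r e ≡ μ · (A₁ r (g j) ⊕ combo P w ν r))

  Expression : Fin n → Set
  Expression e = SpanExpression e ⊎ ShiftExpression e

  span-expression : ∀ e → ¬ Loop F B e → (∀ r → A₁ r e ≡ 𝟘) → SpanExpression e
  span-expression e e-nonloop A₁ₑ≡𝟘 with w-spans e
  ... | l , Pₑ≡ = l , l≢𝟘 , Bₑ≡
    where
    Bₑ≡ : ∀ r → B r e ≡ combo P w l r
    Bₑ≡ r = trans (cong (_⊕ P r e) (A₁ₑ≡𝟘 r)) (trans (+-identityˡ _) (Pₑ≡ r))
    l≢𝟘 : NonzeroVec l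
    l≢𝟘 = Finₚ.¬∀⟶∃¬ k _ (λ i → l i ≟ 𝟘) λ l≡𝟘 →
      e-nonloop (zero-column⇒loop B e (λ r → trans (Bₑ≡ r) (combo-zero P w l≡𝟘 r)))

  shift-expression : ∀ e → ¬ (∀ r → A₁ r e ≡ 𝟘) → ShiftExpression e
  shift-expression e A₁ₑ≢𝟘
    with representative-multiple _≟_ A₁ N-simple e (A₁ₑ≢𝟘 ∘ loop⇒zero-column A₁ e) | w-spans e
  ... | j , μ , A₁ₑ≡ | l , Pₑ≡ = j , ν , μ , μ≢𝟘 , Bₑ≡
    where
    μ≢𝟘 : μ ≢ 𝟘
    μ≢𝟘 μ≡𝟘 = A₁ₑ≢𝟘 (λ r → trans (A₁ₑ≡ r) (trans (cong (_· A₁ r (g j)) μ≡𝟘) (zeroˡ _)))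
    ν : Fin k → Carrier
    ν i = inv μ μ≢𝟘 · l i
    Bₑ≡ : ∀ r → B r e ≡ μ · (A₁ r (g j) ⊕ combo P w ν r)
    Bₑ≡ r = begin
      A₁ r e ⊕ P r e
        ≡⟨ cong₂ _⊕_ (A₁ₑ≡ r) (Pₑ≡ r) ⟩
      μ · A₁ r (g j) ⊕ combo P w l r
        ≡⟨ cong (μ · A₁ r (g j) ⊕_) (combo-cong P w (λ i → sym (inv-cancelʳ μ μ≢𝟘 (l i))) r) ⟩
      μ · A₁ r (g j) ⊕ combo P w (λ i → μ · ν i) r
        ≡⟨ cong (μ · A₁ r (g j) ⊕_) (combo-scale P w μ ν r) ⟨
      μ · A₁ r (g j) ⊕ μ · combo P w ν r
        ≡⟨ distribˡ μ _ _ ⟨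
      μ · (A₁ r (g j) ⊕ combo P w ν r)
        ∎

  express : ∀ e → ¬ Loop F B e → Expression e
  express e e-nonloop with Finₚ.all? (λ r → A₁ r e ≟ 𝟘)
  ... | yes A₁ₑ≡𝟘 = inj₁ (span-expression e e-nonloop A₁ₑ≡𝟘)
  ... | no A₁ₑ≢𝟘  = inj₂ (shift-expression e A₁ₑ≢𝟘)

  record-of : ∀ {e} → Expression e → Fin (q ^ k * εN) ⊎ Fin (geomSum q k)
  record-of (inj₁ (l , l≢𝟘 , _))  = inj₂ (point-code k l l≢𝟘)
  record-of (inj₂ (j , ν , _))    = inj₁ (combine (vector-code k ν) j)

  record-proportional : ∀ {e f} (x : Expression e) (y : Expression f) →
    record-of x ≡ record-of y → Proportional (column B e) (column B f)
  record-proportional (inj₁ (l , l≢𝟘 , Bₑ≡)) (inj₁ (l′ , l′≢𝟘 , B_f≡)) same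
    with combo-proportional P w (point-code-proportional k l l′ l≢𝟘 l′≢𝟘 (inj₂-injective same))
  ... | s , s′ , s≢𝟘 , s·lw≡s′·l′w = s , s′ , s≢𝟘 , λ r →
    trans (cong (s ·_) (Bₑ≡ r)) (trans (s·lw≡s′·l′w r) (cong (s′ ·_) (sym (B_f≡ r))))
  record-proportional (inj₂ (j , ν , μ , _ , Bₑ≡)) (inj₂ (j′ , ν′ , μ′ , μ′≢𝟘 , B_f≡)) same
    with Finₚ.combine-injective (vector-code k ν) j (vector-code k ν′) j′ (inj₁-injective same)
  ... | ν≡ν′ , refl =
    multiples-proportional μ μ′ μ′≢𝟘 (λ r → trans (Bₑ≡ r) (cong (μ ·_) (same-part r))) B_f≡
    where
    same-part : ∀ r → A₁ r (g j) ⊕ combo P w ν r ≡ A₁ r (g j) ⊕ combo P w ν′ r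
    same-part r = cong (A₁ r (g j) ⊕_) (combo-cong P w (vector-code-injective k ν≡ν′) r)
  record-proportional (inj₁ _) (inj₂ _) ()
  record-proportional (inj₂ _) (inj₁ _) ()

  ε-perturbation-bound : ∀ {εM} → HasEpsilon F B εM → εM ≤ q ^ k * εN + geomSum q k
  ε-perturbation-bound M-simple = ε-bound B M-simple label same-label⇒dependent
    where
    label : ∀ e → ¬ Loop F B e → Fin (q ^ k * εN + geomSum q k)
    label e e-nonloop = join _ _ (record-of (express e e-nonloop))
    same-label⇒dependent : ∀ e f e-nonloop f-nonloop → label e e-nonloop ≡ label f f-nonloop →
      Dependent F B (pair F e f)
    same-label⇒dependent e f e-nonloop f-nonloop same =
      proportional⇒dependent B e f
        (record-proportional x y (join-injective _ _ (record-of x) (record-of y) same))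
      where
      x : Expression e
      x = express e e-nonloop
      y : Expression f
      y = express f f-nonloop

geomSum-monotone : ∀ q {k t} → k ≤ t → geomSum q k ≤ geomSum q t
geomSum-monotone q k≤t = go (ℕₚ.≤⇒≤′ k≤t)
  where
  go : ∀ {k t} → k ≤′ t → geomSum q k ≤ geomSum q t
  go ≤′-refl       = ℕₚ.≤-refl
  go (≤′-step k≤t) = ℕₚ.≤-trans (go k≤t) (ℕₚ.m≤n+m _ _)

bound-monotone : ∀ q .{{_ : NonZero q}} ε {k t} → k ≤ t →
  q ^ k * ε + geomSum q k ≤ q ^ t * ε + geomSum q t
bound-monotone q ε k≤t =
  ℕₚ.+-mono-≤ (ℕₚ.*-monoˡ-≤ ε (ℕₚ.^-monoʳ-≤ q k≤t)) (geomSum-monotone q k≤t)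

lemma2p9 : (q t : ℕ) (F : Field) → IsGF q F →
    ∀ {m n} (A₁ P : Matrix F m n) → RankAtMost F t P →
    ∀ (εM εN : ℕ) → HasEpsilon F (_+ᴹ_ F A₁ P) εM → HasEpsilon F A₁ εN →
    εM ≤ q ^ t * εN + geomSum q t
lemma2p9 q t F gf A₁ P rank εM εN M-simple N-simple
  with Spanning.small-spanning-family F P t rank
... | k , k≤t , w , _ , w-spans =
  ℕₚ.≤-trans (Perturbation.ε-perturbation-bound F q gf A₁ P N-simple w w-spans M-simple)
             (bound-monotone q {{q≢0}} εN k≤t)
  where
  -- GF(q) contains 𝟘, so q ≥ 1.
  q≢0 : NonZero q
  q≢0 = Finₚ.nonZeroIndex (Inverse.from gf (Field.𝟘 F))
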